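{- Let $P>1$ be an odd integer and let \[ N(P)=\sum_{D=1}^{P-1}\ \sum_{\epsilon,\eta\in\{1,-1\}} \tau\big((P-\delta_P)\,|\epsilon P+\eta D|\big),\] where $\tau$ is the number-of-positive-divisors function. Then $N(P)=O\big(\tau(P-\delta_P)\,P\log P\big)$.
   Context: Fix an integer $d$; for an odd positive integer $m$, $\delta_m$ denotes the Jacobi symbol $\left(\frac{d}{m}\right)$. The quantity $N(P)$ counts the candidate pairs $(D,\Delta)$ generated by the "$D\Delta$ method": for each $1\le D\le P-1$ and each of the four choices of signs $(\delta_q,\delta_r)\in\{\pm1\}^2$, $\Delta$ runs over the divisors of $(P-\delta_P)(\delta_qP+\delta_rD)$. The implied constant in $O(\cdot)$ is absolute. -}

module Defs where

open import Data.Nat as ℕ using (ℕ; zero; suc; _∸_; _^_; NonZero)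
open import Data.Nat.Divisibility using (_∣?_)
open import Data.Nat.Primality using (prime?)
open import Data.Integer as ℤ using (ℤ; +_; -_; ∣_∣; 0ℤ; 1ℤ; -1ℤ)
open import Data.Integer.DivMod using (_%ℕ_)
open import Data.List using (List; []; _∷_; map; foldr; filter; length)
open import Data.Nat.ListAction using (sum)
open import Data.Bool.ListAction using (any)
open import Data.List.Base using (upTo)
open import Data.Bool using (Bool; if_then_else_)
open import Relation.Nullary.Decidable using (does)

range1 : ℕ → List ℕ
range1 n = map suc (upTo n)

τ : ℕ → ℕ
τ n = length (filter (λ k → k ∣? n) (range1 n))

-- ν p n : p-adic valuation of n (for p ≥ 2, n ≥ 1): number of k ∈ [1..n] with p^k ∣ n
ν : ℕ → ℕ → ℕ
ν p n = length (filter (λ k → (p ^ k) ∣? n) (range1 n))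

legendre : ℤ → (p : ℕ) → .{{NonZero p}} → ℤ
legendre a p =
  if does ((a %ℕ p) ℕ.≟ 0) then 0ℤ
  else (if any (λ x → does (((x ℕ.* x) ℕ.% p) ℕ.≟ (a %ℕ p))) (upTo p)
        then 1ℤ else -1ℤ)

legendrePow : ℤ → ℕ → ℕ → ℤ
legendrePow a zero    e = 1ℤ
legendrePow a (suc q) e = product' e
  where
    product' : ℕ → ℤ
    product' zero    = 1ℤ
    product' (suc k) = legendre a (suc q) ℤ.* product' k

jacobi : ℤ → ℕ → ℤ
jacobi a n = foldr (λ p acc → legendrePow a p (ν p n) ℤ.* acc) 1ℤ
                   (filter (λ p → prime? p) (range1 n))

δ : ℤ → ℕ → ℤ
δ d m = jacobi d m

signs : List ℤ
signs = 1ℤ ∷ -1ℤ ∷ []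

N : ℤ → ℕ → ℕ
N d P = sum (map (λ D → sum (map (λ ε → sum (map (λ η →
          τ (∣ (+ P ℤ.- δ d P) ℤ.* (ε ℤ.* + P ℤ.+ η ℤ.* + D) ∣)) signs)) signs))
        (range1 (P ∸ 1)))

-- Submultiplicativity of τ bounds each summand by τ(P − δ_P) τ(P ± D), and as D runs over
-- 1, …, P − 1 the numbers P − D and P + D are distinct and at most 2P. Hence
-- N(P) ≤ 4 τ(P − δ_P) Σ_{m ≤ 2P} τ(m), and Σ_{m ≤ n} τ(m) = Σ_{k ≤ n} ⌊n/k⌋ ≤ (1 + log₂ n) n,
-- since over each dyadic block 2^j ≤ k < 2^(j+1) the quotients ⌊n/k⌋ sum to at most n.
module Submission where

open import Defs
open import Data.Nat using (ℕ; _*_; _≤_; _<_; _%_; _∸_)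
open import Data.Nat.Logarithm using (⌊log₂_⌋)
open import Data.Integer using (ℤ; +_; ∣_∣; _-_)
open import Data.Product using (∃)
open import Relation.Binary.PropositionalEquality using (_≡_)

open import Data.Nat hiding (∣_-_∣)
open import Data.Nat.Properties
open import Data.Nat.Divisibility
open import Data.Nat.DivMod using (_/_; m≡m%n+[m/n]*n; m%n<n; m/n*n≤m; m*[n/m]≡n)
open import Data.Nat.GCD using (gcd; gcd[m,n]∣m; gcd[m,n]∣n; gcd[m,n]≢0)
open import Data.Nat.Coprimality using (coprime-/gcd; coprime-divisor)
open import Data.Nat.Logarithm using (⌊log₂⌋-mono-≤; ⌊log₂[2*b]⌋≡1+⌊log₂b⌋; ⌊log₂[2^n]⌋≡n)
open import Data.Nat.Logarithm.Core using (⌊log2⌋)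
open import Data.Nat.Tactic.RingSolver using (solve-∀)
open import Data.Nat.Induction using (Acc; acc; <-wellFounded)
open import Data.Nat.ListAction using (sum)
open import Data.Nat.ListAction.Properties using (sum-++)
open import Data.Integer as ℤ using (1ℤ; -1ℤ)
import Data.Integer.Properties as ℤ
open import Data.List using (List; []; _∷_; map; filter; length; upTo; _++_)
open import Data.List.Properties using (upTo-∷ʳ; map-++)
open import Data.Product using (∃₂; _×_; _,_)
open import Data.Sum using (inj₂)
open import Function using (_∘_)
open import Algebra.Properties.CommutativeSemigroup +-commutativeSemigroup
  using () renaming (interchange to +-interchange)
open import Relation.Nullary using (Dec; yes; no; ¬_; contradiction)
open import Relation.Unary using (Pred; Decidable)
open import Relation.Binary.PropositionalEquality
  using (refl; sym; trans; cong; cong₂; subst; subst₂; module ≡-Reasoning)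

𝟙 : ∀ {a} {A : Set a} → Dec A → ℕ
𝟙 (yes _) = 1
𝟙 (no _)  = 0

𝟙-yes : ∀ {a} {A : Set a} (a? : Dec A) → A → 𝟙 a? ≡ 1
𝟙-yes (yes _) _ = refl
𝟙-yes (no ¬a) a = contradiction a ¬a

𝟙-no : ∀ {a} {A : Set a} (a? : Dec A) → ¬ A → 𝟙 a? ≡ 0
𝟙-no (yes a) ¬a = contradiction a ¬a
𝟙-no (no _)  _  = refl

length-filter≡sum-𝟙 : ∀ {a p} {A : Set a} {P : Pred A p} (P? : Decidable P) (xs : List A) →
                      length (filter P? xs) ≡ sum (map (𝟙 ∘ P?) xs)
length-filter≡sum-𝟙 P? []       = refl
length-filter≡sum-𝟙 P? (x ∷ xs) with P? x
... | yes _ = cong suc (length-filter≡sum-𝟙 P? xs)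
... | no _  = length-filter≡sum-𝟙 P? xs

∑₁ : ℕ → (ℕ → ℕ) → ℕ
∑₁ zero    f = 0
∑₁ (suc n) f = ∑₁ n f + f (suc n)

infix 10 ∑₁
syntax ∑₁ n (λ k → e) = ∑[ 1≤ k ≤ n ] e

sum-map-range1 : ∀ f n → sum (map f (range1 n)) ≡ ∑₁ n f
sum-map-range1 f zero    = refl
sum-map-range1 f (suc n) = begin
  sum (map f (map suc (upTo (suc n))))        ≡⟨ cong (sum ∘ map f ∘ map suc) (sym (upTo-∷ʳ n)) ⟩
  sum (map f (map suc (upTo n ++ n ∷ [])))    ≡⟨ cong (sum ∘ map f) (map-++ suc (upTo n) (n ∷ [])) ⟩
  sum (map f (range1 n ++ suc n ∷ []))        ≡⟨ cong sum (map-++ f (range1 n) (suc n ∷ [])) ⟩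
  sum (map f (range1 n) ++ f (suc n) ∷ [])    ≡⟨ sum-++ (map f (range1 n)) (f (suc n) ∷ []) ⟩
  sum (map f (range1 n)) + (f (suc n) + 0)    ≡⟨ cong₂ _+_ (sum-map-range1 f n) (+-identityʳ _) ⟩
  ∑₁ n f + f (suc n)                          ∎
  where open ≡-Reasoning

module _ {f g : ℕ → ℕ} where

  ∑₁-cong : ∀ n → (∀ {k} → 1 ≤ k → k ≤ n → f k ≡ g k) → ∑₁ n f ≡ ∑₁ n g
  ∑₁-cong zero    _  = refl
  ∑₁-cong (suc n) eq = cong₂ _+_ (∑₁-cong n λ k≥1 k≤n → eq k≥1 (m≤n⇒m≤1+n k≤n)) (eq z<s ≤-refl)

  ∑₁-mono-≤ : ∀ n → (∀ {k} → 1 ≤ k → k ≤ n → f k ≤ g k) → ∑₁ n f ≤ ∑₁ n g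
  ∑₁-mono-≤ zero    _  = z≤n
  ∑₁-mono-≤ (suc n) le = +-mono-≤ (∑₁-mono-≤ n λ k≥1 k≤n → le k≥1 (m≤n⇒m≤1+n k≤n)) (le z<s ≤-refl)

  ∑₁-distrib-+ : ∀ n → ∑[ 1≤ k ≤ n ] (f k + g k) ≡ ∑₁ n f + ∑₁ n g
  ∑₁-distrib-+ zero    = refl
  ∑₁-distrib-+ (suc n) = begin
    ∑[ 1≤ k ≤ n ] (f k + g k) + (f (suc n) + g (suc n))
      ≡⟨ cong (_+ (f (suc n) + g (suc n))) (∑₁-distrib-+ n) ⟩
    (∑₁ n f + ∑₁ n g) + (f (suc n) + g (suc n))
      ≡⟨ +-interchange (∑₁ n f) (∑₁ n g) (f (suc n)) (g (suc n)) ⟩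
    (∑₁ n f + f (suc n)) + (∑₁ n g + g (suc n)) ∎
    where open ≡-Reasoning

∑₁-const : ∀ c n → ∑[ 1≤ k ≤ n ] c ≡ n * c
∑₁-const c zero    = refl
∑₁-const c (suc n) = trans (cong (_+ c) (∑₁-const c n)) (+-comm (n * c) c)

∑₁-*ʳ : ∀ f c n → ∑[ 1≤ k ≤ n ] (f k * c) ≡ ∑₁ n f * c
∑₁-*ʳ f c zero    = refl
∑₁-*ʳ f c (suc n) = trans (cong (_+ f (suc n) * c) (∑₁-*ʳ f c n)) (sym (*-distribʳ-+ c (∑₁ n f) (f (suc n))))

∑₁-*ˡ : ∀ c f n → ∑[ 1≤ k ≤ n ] (c * f k) ≡ c * ∑₁ n f
∑₁-*ˡ c f n = begin
  ∑[ 1≤ k ≤ n ] (c * f k) ≡⟨ ∑₁-cong n (λ {k} _ _ → *-comm c (f k)) ⟩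
  ∑[ 1≤ k ≤ n ] (f k * c) ≡⟨ ∑₁-*ʳ f c n ⟩
  ∑₁ n f * c              ≡⟨ *-comm (∑₁ n f) c ⟩
  c * ∑₁ n f              ∎
  where open ≡-Reasoning

∑₁-comm : ∀ (f : ℕ → ℕ → ℕ) m n →
          ∑[ 1≤ i ≤ m ] ∑[ 1≤ j ≤ n ] f i j ≡ ∑[ 1≤ j ≤ n ] ∑[ 1≤ i ≤ m ] f i j
∑₁-comm f zero    n = sym (trans (∑₁-const 0 n) (*-zeroʳ n))
∑₁-comm f (suc m) n = begin
  ∑[ 1≤ i ≤ m ] ∑[ 1≤ j ≤ n ] f i j + ∑[ 1≤ j ≤ n ] f (suc m) j
    ≡⟨ cong (_+ ∑[ 1≤ j ≤ n ] f (suc m) j) (∑₁-comm f m n) ⟩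
  ∑[ 1≤ j ≤ n ] ∑[ 1≤ i ≤ m ] f i j + ∑[ 1≤ j ≤ n ] f (suc m) j
    ≡⟨ ∑₁-distrib-+ n ⟨
  ∑[ 1≤ j ≤ n ] (∑[ 1≤ i ≤ m ] f i j + f (suc m) j)
    ∎
  where open ≡-Reasoning

∑₁-split : ∀ f m n → ∑₁ (m + n) f ≡ ∑₁ m f + ∑[ 1≤ i ≤ n ] f (m + i)
∑₁-split f m zero    = trans (cong (λ k → ∑₁ k f) (+-identityʳ m)) (sym (+-identityʳ _))
∑₁-split f m (suc n) = begin
  ∑₁ (m + suc n) f                                         ≡⟨ cong (λ k → ∑₁ k f) (+-suc m n) ⟩
  ∑₁ (m + n) f + f (suc (m + n))                           ≡⟨ cong₂ _+_ (∑₁-split f m n) (cong f (sym (+-suc m n))) ⟩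
  ∑₁ m f + ∑[ 1≤ i ≤ n ] f (m + i) + f (m + suc n)         ≡⟨ +-assoc (∑₁ m f) _ _ ⟩
  ∑₁ m f + (∑[ 1≤ i ≤ n ] f (m + i) + f (m + suc n))       ∎
  where open ≡-Reasoning

∑₁-monoˡ-≤ : ∀ f {m n} → m ≤ n → ∑₁ m f ≤ ∑₁ n f
∑₁-monoˡ-≤ f {m} {n} m≤n = begin
  ∑₁ m f                                  ≤⟨ m≤m+n (∑₁ m f) _ ⟩
  ∑₁ m f + ∑[ 1≤ i ≤ n ∸ m ] f (m + i)   ≡⟨ ∑₁-split f m (n ∸ m) ⟨
  ∑₁ (m + (n ∸ m)) f                      ≡⟨ cong (λ k → ∑₁ k f) (m+[n∸m]≡n m≤n) ⟩
  ∑₁ n f                                  ∎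
  where open ≤-Reasoning

∑₁-extend : ∀ f {m n} → m ≤ n → (∀ {k} → m < k → k ≤ n → f k ≡ 0) → ∑₁ m f ≡ ∑₁ n f
∑₁-extend f {m} {n} m≤n tail≡0 = begin
  ∑₁ m f                                  ≡⟨ +-identityʳ (∑₁ m f) ⟨
  ∑₁ m f + 0                              ≡⟨ cong (λ s → ∑₁ m f + s) tail-sum≡0 ⟨
  ∑₁ m f + ∑[ 1≤ i ≤ n ∸ m ] f (m + i)   ≡⟨ ∑₁-split f m (n ∸ m) ⟨
  ∑₁ (m + (n ∸ m)) f                      ≡⟨ cong (λ k → ∑₁ k f) (m+[n∸m]≡n m≤n) ⟩
  ∑₁ n f                                  ∎
  where
  open ≡-Reasoning
  tail-sum≡0 : ∑[ 1≤ i ≤ n ∸ m ] f (m + i) ≡ 0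
  tail-sum≡0 = begin
    ∑[ 1≤ i ≤ n ∸ m ] f (m + i) ≡⟨ ∑₁-cong (n ∸ m) (λ {i} i≥1 i≤n∸m →
      tail≡0 (subst (_≤ m + i) (+-comm m 1) (+-monoʳ-≤ m i≥1))
             (subst (m + i ≤_) (m+[n∸m]≡n m≤n) (+-monoʳ-≤ m i≤n∸m))) ⟩
    ∑[ 1≤ i ≤ n ∸ m ] 0         ≡⟨ ∑₁-const 0 (n ∸ m) ⟩
    (n ∸ m) * 0                 ≡⟨ *-zeroʳ (n ∸ m) ⟩
    0                           ∎

∑₁-term : ∀ f {k n} → 1 ≤ k → k ≤ n → f k ≤ ∑₁ n f
∑₁-term f {suc k} _ k<n = ≤-trans (m≤n+m (f (suc k)) (∑₁ k f)) (∑₁-monoˡ-≤ f k<n)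

∑₁-reverse : ∀ f n → ∑[ 1≤ k ≤ n ] f (suc n ∸ k) ≡ ∑₁ n f
∑₁-reverse f zero    = refl
∑₁-reverse f (suc n) = begin
  ∑[ 1≤ k ≤ n ] f (suc (suc n) ∸ k) + f (suc n ∸ n)
    ≡⟨ cong₂ _+_ (∑₁-cong n λ {k} _ k≤n → cong f (+-∸-assoc 1 (m≤n⇒m≤1+n k≤n)))
                 (cong f (m+n∸n≡m 1 n)) ⟩
  ∑[ 1≤ k ≤ n ] f (suc (suc n ∸ k)) + f 1
    ≡⟨ cong (_+ f 1) (∑₁-reverse (f ∘ suc) n) ⟩
  ∑[ 1≤ k ≤ n ] f (suc k) + f 1
    ≡⟨ +-comm _ (f 1) ⟩
  f 1 + ∑[ 1≤ k ≤ n ] f (suc k)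
    ≡⟨ ∑₁-split f 1 n ⟨
  ∑₁ (suc n) f
    ∎
  where open ≡-Reasoning

τ≡∑₁ : ∀ n {m} .{{_ : NonZero n}} → n ≤ m → τ n ≡ ∑[ 1≤ k ≤ m ] 𝟙 (k ∣? n)
τ≡∑₁ n {m} n≤m = begin
  τ n                                 ≡⟨ length-filter≡sum-𝟙 (_∣? n) (range1 n) ⟩
  sum (map (𝟙 ∘ (_∣? n)) (range1 n))  ≡⟨ sum-map-range1 (𝟙 ∘ (_∣? n)) n ⟩
  ∑[ 1≤ k ≤ n ] 𝟙 (k ∣? n)            ≡⟨ ∑₁-extend (𝟙 ∘ (_∣? n)) n≤m
                                           (λ n<k _ → 𝟙-no (_ ∣? n) (<⇒≱ n<k ∘ ∣⇒≤)) ⟩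
  ∑[ 1≤ k ≤ m ] 𝟙 (k ∣? n)            ∎
  where open ≡-Reasoning

-- u = gcd k a, and k / u divides b because it is coprime to a / u.
∣*⇒∃factors : ∀ {k} a b .{{_ : NonZero a}} → k ∣ a * b → ∃₂ λ u v → (u ∣ a) × (v ∣ b) × (k ≡ u * v)
∣*⇒∃factors {k} a b k∣ab = g , k / g , gcd[m,n]∣n k a , k/g∣b , sym (m*[n/m]≡n (gcd[m,n]∣m k a))
  where
  g = gcd k a
  instance
    g≢0 : NonZero g
    g≢0 = ≢-nonZero (gcd[m,n]≢0 k a (inj₂ (≢-nonZero⁻¹ a)))
  g*[k/g]∣g*[[a/g]*b] : g * (k / g) ∣ g * ((a / g) * b)
  g*[k/g]∣g*[[a/g]*b] = subst₂ _∣_ (sym (m*[n/m]≡n (gcd[m,n]∣m k a)))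
    (trans (cong (_* b) (sym (m*[n/m]≡n (gcd[m,n]∣n k a)))) (*-assoc g (a / g) b)) k∣ab
  k/g∣b : k / g ∣ b
  k/g∣b = coprime-divisor (coprime-/gcd k a) (*-cancelˡ-∣ g g*[k/g]∣g*[[a/g]*b])

∣⇒>0 : ∀ {m n} .{{_ : NonZero n}} → m ∣ n → 0 < m
∣⇒>0 {zero}  {n} 0∣n = contradiction (0∣⇒≡0 0∣n) (≢-nonZero⁻¹ n)
∣⇒>0 {suc _} _       = z<s

∑₁-𝟙≟≤1 : ∀ c n → ∑[ 1≤ k ≤ n ] 𝟙 (k ≟ c) ≤ 1
∑₁-𝟙≟≤1 c zero = z≤n
∑₁-𝟙≟≤1 c (suc n) with suc n ≟ c
... | no _     = ≤-trans (≤-reflexive (+-identityʳ _)) (∑₁-𝟙≟≤1 c n)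
... | yes refl = ≤-reflexive (cong (_+ 1) earlier≡0)
  where
  earlier≡0 : ∑[ 1≤ k ≤ n ] 𝟙 (k ≟ suc n) ≡ 0
  earlier≡0 = sym (∑₁-extend (λ k → 𝟙 (k ≟ suc n)) z≤n
                    (λ {k} _ k≤n → 𝟙-no (k ≟ suc n) λ { refl → <-irrefl refl k≤n }))

τ-submultiplicative : ∀ a b → τ (a * b) ≤ τ a * τ b
τ-submultiplicative zero    _    = z≤n
τ-submultiplicative (suc a) zero rewrite *-zeroʳ a = z≤n
τ-submultiplicative a@(suc _) b@(suc _) = begin
  τ (a * b)
    ≡⟨ τ≡∑₁ (a * b) ≤-refl ⟩
  ∑[ 1≤ k ≤ a * b ] 𝟙 (k ∣? a * b)
    ≤⟨ ∑₁-mono-≤ (a * b) (λ {k} _ _ → divisor-witness k) ⟩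
  ∑[ 1≤ k ≤ a * b ] ∑[ 1≤ u ≤ a ] ∑[ 1≤ v ≤ b ] E k u v
    ≡⟨ ∑₁-comm (λ k u → ∑[ 1≤ v ≤ b ] E k u v) (a * b) a ⟩
  ∑[ 1≤ u ≤ a ] ∑[ 1≤ k ≤ a * b ] ∑[ 1≤ v ≤ b ] E k u v
    ≡⟨ ∑₁-cong a (λ {u} _ _ → ∑₁-comm (λ k v → E k u v) (a * b) b) ⟩
  ∑[ 1≤ u ≤ a ] ∑[ 1≤ v ≤ b ] ∑[ 1≤ k ≤ a * b ] E k u v
    ≤⟨ ∑₁-mono-≤ a (λ {u} _ _ → ∑₁-mono-≤ b λ {v} _ _ → unique-product u v) ⟩
  ∑[ 1≤ u ≤ a ] ∑[ 1≤ v ≤ b ] (𝟙 (u ∣? a) * 𝟙 (v ∣? b))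
    ≡⟨ ∑₁-cong a (λ {u} _ _ → ∑₁-*ˡ (𝟙 (u ∣? a)) (λ v → 𝟙 (v ∣? b)) b) ⟩
  ∑[ 1≤ u ≤ a ] (𝟙 (u ∣? a) * ∑[ 1≤ v ≤ b ] 𝟙 (v ∣? b))
    ≡⟨ ∑₁-*ʳ (λ u → 𝟙 (u ∣? a)) _ a ⟩
  ∑[ 1≤ u ≤ a ] 𝟙 (u ∣? a) * ∑[ 1≤ v ≤ b ] 𝟙 (v ∣? b)
    ≡⟨ cong₂ _*_ (τ≡∑₁ a ≤-refl) (τ≡∑₁ b ≤-refl) ⟨
  τ a * τ b
    ∎
  where
  open ≤-Reasoning
  E : ℕ → ℕ → ℕ → ℕ
  E k u v = 𝟙 (k ≟ u * v) * (𝟙 (u ∣? a) * 𝟙 (v ∣? b))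

  divisor-witness : ∀ k → 𝟙 (k ∣? a * b) ≤ ∑[ 1≤ u ≤ a ] ∑[ 1≤ v ≤ b ] E k u v
  divisor-witness k with k ∣? a * b
  ... | no _    = z≤n
  ... | yes k∣ab with ∣*⇒∃factors a b k∣ab
  ... | u , v , u∣a , v∣b , k≡uv = begin
    1                                     ≡⟨ cong₂ _*_ (𝟙-yes (k ≟ u * v) k≡uv)
                                               (cong₂ _*_ (𝟙-yes (u ∣? a) u∣a) (𝟙-yes (v ∣? b) v∣b)) ⟨
    E k u v                               ≤⟨ ∑₁-term (E k u) (∣⇒>0 v∣b) (∣⇒≤ v∣b) ⟩
    ∑[ 1≤ v ≤ b ] E k u v                 ≤⟨ ∑₁-term (λ u → ∑[ 1≤ v ≤ b ] E k u v) (∣⇒>0 u∣a) (∣⇒≤ u∣a) ⟩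
    ∑[ 1≤ u ≤ a ] ∑[ 1≤ v ≤ b ] E k u v   ∎

  unique-product : ∀ u v → ∑[ 1≤ k ≤ a * b ] E k u v ≤ 𝟙 (u ∣? a) * 𝟙 (v ∣? b)
  unique-product u v = begin
    ∑[ 1≤ k ≤ a * b ] E k u v                        ≡⟨ ∑₁-*ʳ (λ k → 𝟙 (k ≟ u * v)) _ (a * b) ⟩
    ∑[ 1≤ k ≤ a * b ] 𝟙 (k ≟ u * v) * (𝟙 (u ∣? a) * 𝟙 (v ∣? b))
                                                     ≤⟨ *-monoˡ-≤ _ (∑₁-𝟙≟≤1 (u * v) (a * b)) ⟩
    1 * (𝟙 (u ∣? a) * 𝟙 (v ∣? b))                    ≡⟨ *-identityˡ _ ⟩
    𝟙 (u ∣? a) * 𝟙 (v ∣? b)                          ∎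

∑₁-multiples-qr : ∀ k q {r} → r < k → ∑[ 1≤ m ≤ q * k + r ] 𝟙 (k ∣? m) ≡ q
∑₁-multiples-qr k       zero    {zero}  _ = refl
∑₁-multiples-qr (suc c) (suc q) {zero}  _ = begin
  ∑₁ (suc q * suc c + 0) multiple            ≡⟨ cong (λ m → ∑₁ m multiple) (trans (+-identityʳ _) end≡) ⟩
  ∑₁ (q * suc c + c) multiple + multiple end ≡⟨ cong₂ _+_ (∑₁-multiples-qr (suc c) q ≤-refl)
                                                        (𝟙-yes (suc c ∣? end) (subst (suc c ∣_) end≡ (n∣m*n (suc q)))) ⟩
  q + 1                                      ≡⟨ +-comm q 1 ⟩
  suc q                                      ∎
  where
  open ≡-Reasoning
  multiple : ℕ → ℕ
  multiple m = 𝟙 (suc c ∣? m)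
  end : ℕ
  end = suc (q * suc c + c)
  end≡ : suc q * suc c ≡ end
  end≡ = trans (+-comm (suc c) (q * suc c)) (+-suc (q * suc c) c)
∑₁-multiples-qr k q {suc r} r<k = begin
  ∑₁ (q * k + suc r) multiple                           ≡⟨ cong (λ m → ∑₁ m multiple) (+-suc (q * k) r) ⟩
  ∑₁ (q * k + r) multiple + multiple (suc (q * k + r))  ≡⟨ cong₂ _+_ (∑₁-multiples-qr k q (<⇒≤ r<k))
                                                                     (𝟙-no (k ∣? _) k∤) ⟩
  q + 0                                                 ≡⟨ +-identityʳ q ⟩
  q                                                     ∎
  where
  open ≡-Reasoning
  multiple : ℕ → ℕ
  multiple m = 𝟙 (k ∣? m)
  k∤ : ¬ (k ∣ suc (q * k + r))
  k∤ k∣ = <⇒≱ r<k (∣⇒≤ (∣m+n∣m⇒∣n (subst (k ∣_) (sym (+-suc (q * k) r)) k∣) (n∣m*n q)))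

∑₁-multiples : ∀ n k .{{_ : NonZero k}} → ∑[ 1≤ m ≤ n ] 𝟙 (k ∣? m) ≡ n / k
∑₁-multiples n k = begin
  ∑[ 1≤ m ≤ n ] 𝟙 (k ∣? m)                 ≡⟨ cong (λ n → ∑[ 1≤ m ≤ n ] 𝟙 (k ∣? m)) n≡qk+r ⟩
  ∑[ 1≤ m ≤ n / k * k + n % k ] 𝟙 (k ∣? m) ≡⟨ ∑₁-multiples-qr k (n / k) (m%n<n n k) ⟩
  n / k                                     ∎
  where
  open ≡-Reasoning
  n≡qk+r : n ≡ n / k * k + n % k
  n≡qk+r = trans (m≡m%n+[m/n]*n n k) (+-comm (n % k) _)

-- Splits 1 ≤ k < 2^j into the dyadic blocks [2^i, 2^(i+1)), on each of which g k ≤ n / 2^i.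
∑₁-dyadic : ∀ {g : ℕ → ℕ} {n} → (∀ {k} → 1 ≤ k → g k * k ≤ n) → ∀ j → ∑₁ (pred (2 ^ j)) g ≤ j * n
∑₁-dyadic g*k≤n zero = z≤n
∑₁-dyadic {g} {n} g*k≤n (suc j) with 2 ^ j in 2^j≡
... | zero  = contradiction 2^j≡ (≢-nonZero⁻¹ (2 ^ j) {{m^n≢0 2 j}})
... | suc a = begin
  ∑₁ (a + (suc a + 0)) g                      ≡⟨ cong (λ m → ∑₁ (a + m) g) (+-identityʳ (suc a)) ⟩
  ∑₁ (a + suc a) g                            ≡⟨ ∑₁-split g a (suc a) ⟩
  ∑₁ a g + ∑[ 1≤ i ≤ suc a ] g (a + i)        ≤⟨ +-mono-≤ first-blocks last-block ⟩
  j * n + n                                   ≡⟨ +-comm (j * n) n ⟩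
  suc j * n                                   ∎
  where
  open ≤-Reasoning
  first-blocks : ∑₁ a g ≤ j * n
  first-blocks = subst (λ m → ∑₁ (pred m) g ≤ j * n) 2^j≡ (∑₁-dyadic g*k≤n j)
  last-block : ∑[ 1≤ i ≤ suc a ] g (a + i) ≤ n
  last-block = *-cancelʳ-≤ _ n (suc a) (begin
    ∑[ 1≤ i ≤ suc a ] g (a + i) * suc a   ≡⟨ ∑₁-*ʳ (λ i → g (a + i)) (suc a) (suc a) ⟨
    ∑[ 1≤ i ≤ suc a ] (g (a + i) * suc a) ≤⟨ ∑₁-mono-≤ (suc a) (λ {i} i≥1 _ →
      let a<a+i = subst (_≤ a + i) (+-comm a 1) (+-monoʳ-≤ a i≥1)
      in ≤-trans (*-monoʳ-≤ (g (a + i)) a<a+i) (g*k≤n (≤-trans z<s a<a+i))) ⟩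
    ∑[ 1≤ i ≤ suc a ] n                   ≡⟨ ∑₁-const n (suc a) ⟩
    suc a * n                             ≡⟨ *-comm (suc a) n ⟩
    n * suc a                             ∎)

n<2*suc⌊n/2⌋ : ∀ n → n < 2 * suc ⌊ n /2⌋
n<2*suc⌊n/2⌋ zero          = z<s
n<2*suc⌊n/2⌋ (suc zero)    = s<s z<s
n<2*suc⌊n/2⌋ (suc (suc n)) = subst (2 + n <_) (sym (*-suc 2 (suc ⌊ n /2⌋))) (s<s (s<s (n<2*suc⌊n/2⌋ n)))

-- Stated for the accessibility-indexed ⌊log2⌋, which ⌊log₂_⌋ unfolds to, so that the
-- recursion can follow the one in its definition.
n<2^suc⌊log2⌋ : ∀ n (rec : Acc _<_ n) → n < 2 ^ suc (⌊log2⌋ n rec)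
n<2^suc⌊log2⌋ zero          _        = z<s
n<2^suc⌊log2⌋ (suc zero)    _        = s<s z<s
n<2^suc⌊log2⌋ (suc (suc n)) (acc rs) = <-≤-trans (n<2*suc⌊n/2⌋ (suc (suc n)))
  (*-monoʳ-≤ 2 (n<2^suc⌊log2⌋ (suc ⌊ n /2⌋) (rs (⌊n/2⌋<n (suc n)))))

n<2^suc⌊log₂n⌋ : ∀ n → n < 2 ^ suc ⌊log₂ n ⌋
n<2^suc⌊log₂n⌋ n = n<2^suc⌊log2⌋ n (<-wellFounded n)

∑₁-τ≤ : ∀ n → ∑[ 1≤ m ≤ n ] τ m ≤ suc ⌊log₂ n ⌋ * n
∑₁-τ≤ n = begin
  ∑[ 1≤ m ≤ n ] τ m                          ≡⟨ ∑₁-cong n (λ {m} m≥1 m≤n → τ≡∑₁ m {{>-nonZero m≥1}} m≤n) ⟩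
  ∑[ 1≤ m ≤ n ] ∑[ 1≤ k ≤ n ] 𝟙 (k ∣? m)     ≡⟨ ∑₁-comm (λ m k → 𝟙 (k ∣? m)) n n ⟩
  ∑₁ n multiples                             ≤⟨ ∑₁-monoˡ-≤ multiples (<⇒≤pred (n<2^suc⌊log₂n⌋ n)) ⟩
  ∑₁ (pred (2 ^ suc ⌊log₂ n ⌋)) multiples    ≤⟨ ∑₁-dyadic multiples*k≤n (suc ⌊log₂ n ⌋) ⟩
  suc ⌊log₂ n ⌋ * n                          ∎
  where
  open ≤-Reasoning
  multiples : ℕ → ℕ
  multiples k = ∑[ 1≤ m ≤ n ] 𝟙 (k ∣? m)
  multiples*k≤n : ∀ {k} → 1 ≤ k → multiples k * k ≤ n
  multiples*k≤n {k} k≥1 = let instance _ = >-nonZero k≥1 in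
    subst (λ c → c * k ≤ n) (sym (∑₁-multiples n k)) (m/n*n≤m n k)

∣P+D∣≡P+D : ∀ P D → ∣ 1ℤ ℤ.* + P ℤ.+ 1ℤ ℤ.* + D ∣ ≡ P + D
∣P+D∣≡P+D P D rewrite ℤ.*-identityˡ (+ P) | ℤ.*-identityˡ (+ D) = refl

∣P-D∣≡P∸D : ∀ {P D} → D ≤ P → ∣ 1ℤ ℤ.* + P ℤ.+ -1ℤ ℤ.* + D ∣ ≡ P ∸ D
∣P-D∣≡P∸D {P} {zero}  _   rewrite ℤ.*-identityˡ (+ P) = cong ∣_∣ (ℤ.+-identityʳ (+ P))
∣P-D∣≡P∸D {P} {suc D} D≤P rewrite ℤ.*-identityˡ (+ P) | +-identityʳ D =
  trans (ℤ.∣m⊖n∣≡∣n⊖m∣ P (suc D)) (ℤ.∣⊖∣-≤ D≤P)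

∣-P+D∣≡P∸D : ∀ {P D} → D ≤ P → ∣ -1ℤ ℤ.* + P ℤ.+ 1ℤ ℤ.* + D ∣ ≡ P ∸ D
∣-P+D∣≡P∸D {zero}  z≤n = refl
∣-P+D∣≡P∸D {suc P} {D} D≤P rewrite ℤ.*-identityˡ (+ D) | +-identityʳ P = ℤ.∣⊖∣-≤ D≤P

∣-P-D∣≡P+D : ∀ P D → ∣ -1ℤ ℤ.* + P ℤ.+ -1ℤ ℤ.* + D ∣ ≡ P + D
∣-P-D∣≡P+D P D rewrite ℤ.-1*i≡-i (+ P) | ℤ.-1*i≡-i (+ D) =
  trans (cong ∣_∣ (sym (ℤ.neg-distrib-+ (+ P) (+ D)))) (ℤ.∣-i∣≡∣i∣ (+ (P + D)))

τ∣X*Y∣≤ : ∀ X Y {v} → ∣ Y ∣ ≡ v → τ ∣ X ℤ.* Y ∣ ≤ τ ∣ X ∣ * τ v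
τ∣X*Y∣≤ X Y refl = subst (λ m → τ m ≤ τ ∣ X ∣ * τ ∣ Y ∣) (sym (ℤ.abs-* X Y)) (τ-submultiplicative ∣ X ∣ ∣ Y ∣)

-- The summand of N for a given D, with P − δ_P generalised to an arbitrary integer X.
τ±± : ℤ → ℕ → ℕ → ℕ
τ±± X P D = sum (map (λ ε → sum (map (λ η → τ ∣ X ℤ.* (ε ℤ.* + P ℤ.+ η ℤ.* + D) ∣) signs)) signs)

τ±±≤ : ∀ X {P D} → D ≤ P → τ±± X P D ≤ 4 * (τ ∣ X ∣ * (τ (P + D) + τ (P ∸ D)))
τ±±≤ X {P} {D} D≤P = begin
  τ±± X P D
    ≤⟨ +-mono-≤ (+-mono-≤ (plus (∣P+D∣≡P+D P D)) (+-monoˡ-≤ 0 (minus (∣P-D∣≡P∸D D≤P))))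
                (+-monoˡ-≤ 0 (+-mono-≤ (minus (∣-P+D∣≡P∸D D≤P)) (+-monoˡ-≤ 0 (plus (∣-P-D∣≡P+D P D))))) ⟩
  B + (B + 0) + (B + (B + 0) + 0)
    ≡⟨ four-times B ⟩
  4 * B
    ∎
  where
  open ≤-Reasoning
  B = τ ∣ X ∣ * (τ (P + D) + τ (P ∸ D))
  plus : ∀ {Y} → ∣ Y ∣ ≡ P + D → τ ∣ X ℤ.* Y ∣ ≤ B
  plus {Y} eq = ≤-trans (τ∣X*Y∣≤ X Y eq) (*-monoʳ-≤ (τ ∣ X ∣) (m≤m+n _ _))
  minus : ∀ {Y} → ∣ Y ∣ ≡ P ∸ D → τ ∣ X ℤ.* Y ∣ ≤ B
  minus {Y} eq = ≤-trans (τ∣X*Y∣≤ X Y eq) (*-monoʳ-≤ (τ ∣ X ∣) (m≤n+m _ _))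
  four-times : ∀ b → b + (b + 0) + (b + (b + 0) + 0) ≡ 4 * b
  four-times = solve-∀

∑₁-τ[P±D]≤ : ∀ L → ∑[ 1≤ D ≤ L ] (τ (suc L + D) + τ (suc L ∸ D)) ≤ ∑[ 1≤ m ≤ 2 * suc L ] τ m
∑₁-τ[P±D]≤ L = begin
  ∑[ 1≤ D ≤ L ] (τ (P + D) + τ (P ∸ D))              ≡⟨ ∑₁-distrib-+ L ⟩
  ∑[ 1≤ D ≤ L ] τ (P + D) + ∑[ 1≤ D ≤ L ] τ (P ∸ D)  ≡⟨ cong (λ s → ∑[ 1≤ D ≤ L ] τ (P + D) + s) (∑₁-reverse τ L) ⟩
  ∑[ 1≤ D ≤ L ] τ (P + D) + ∑₁ L τ                   ≤⟨ +-mono-≤ (∑₁-monoˡ-≤ (λ D → τ (P + D)) (n≤1+n L))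
                                                                  (∑₁-monoˡ-≤ τ (n≤1+n L)) ⟩
  ∑[ 1≤ D ≤ P ] τ (P + D) + ∑₁ P τ                   ≡⟨ +-comm _ (∑₁ P τ) ⟩
  ∑₁ P τ + ∑[ 1≤ D ≤ P ] τ (P + D)                   ≡⟨ ∑₁-split τ P P ⟨
  ∑₁ (P + P) τ                                       ≡⟨ cong (λ m → ∑₁ (P + m) τ) (+-identityʳ P) ⟨
  ∑₁ (2 * P) τ                                       ∎
  where
  open ≤-Reasoning
  P = suc L

2+n≤3n : ∀ {n} → 1 ≤ n → 2 + n ≤ 3 * n
2+n≤3n {suc n} _ = subst (3 + n ≤_) (3+3n≡3[1+n] n) (+-monoʳ-≤ 3 (m≤n*m n 3))
  where
  3+3n≡3[1+n] : ∀ n → 3 + 3 * n ≡ 3 * (1 + n)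
  3+3n≡3[1+n] = solve-∀

∑₁-τ±±≤ : ∀ X P → 1 < P → ∑[ 1≤ D ≤ P ∸ 1 ] τ±± X P D ≤ 24 * τ ∣ X ∣ * P * ⌊log₂ P ⌋
∑₁-τ±±≤ X P@(suc L) 1<P = begin
  ∑[ 1≤ D ≤ L ] τ±± X P D                                  ≤⟨ ∑₁-mono-≤ L (λ _ D≤L → τ±±≤ X (m≤n⇒m≤1+n D≤L)) ⟩
  ∑[ 1≤ D ≤ L ] (4 * (t * H D))                            ≡⟨ ∑₁-*ˡ 4 (λ D → t * H D) L ⟩
  4 * ∑[ 1≤ D ≤ L ] (t * H D)                              ≡⟨ cong (4 *_) (∑₁-*ˡ t H L) ⟩
  4 * (t * ∑₁ L H)                                         ≤⟨ *-monoʳ-≤ 4 (*-monoʳ-≤ t (≤-trans (∑₁-τ[P±D]≤ L) (∑₁-τ≤ (2 * P)))) ⟩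
  4 * (t * (suc ⌊log₂ (2 * P) ⌋ * (2 * P)))                ≡⟨ cong (λ l → 4 * (t * (suc l * (2 * P)))) (⌊log₂[2*b]⌋≡1+⌊log₂b⌋ P) ⟩
  4 * (t * ((2 + ℓ) * (2 * P)))                            ≤⟨ *-monoʳ-≤ 4 (*-monoʳ-≤ t (*-monoˡ-≤ (2 * P) (2+n≤3n ℓ≥1))) ⟩
  4 * (t * (3 * ℓ * (2 * P)))                              ≡⟨ regroup t ℓ P ⟩
  24 * t * P * ℓ                                           ∎
  where
  open ≤-Reasoning
  t = τ ∣ X ∣
  ℓ = ⌊log₂ P ⌋
  H : ℕ → ℕ
  H D = τ (P + D) + τ (P ∸ D)
  ℓ≥1 : 1 ≤ ℓ
  ℓ≥1 = subst (_≤ ℓ) (⌊log₂[2^n]⌋≡n 1) (⌊log₂⌋-mono-≤ 1<P)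
  regroup : ∀ t ℓ P → 4 * (t * (3 * ℓ * (2 * P))) ≡ 24 * t * P * ℓ
  regroup = solve-∀

-- The bound depends neither on the value of the Jacobi symbol nor on the parity of P.
theorem6 : ∃ λ (C : ℕ) → (d : ℤ) (P : ℕ) → P % 2 ≡ 1 → 1 < P →
    N d P ≤ C * τ ∣ + P - δ d P ∣ * P * ⌊log₂ P ⌋
theorem6 = 24 , λ d P _ 1<P → begin
  N d P                                          ≡⟨ sum-map-range1 (τ±± (+ P - δ d P) P) (P ∸ 1) ⟩
  ∑[ 1≤ D ≤ P ∸ 1 ] τ±± (+ P - δ d P) P D        ≤⟨ ∑₁-τ±±≤ (+ P - δ d P) P 1<P ⟩
  24 * τ ∣ + P - δ d P ∣ * P * ⌊log₂ P ⌋         ∎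
  where open ≤-Reasoning
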